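{- Let $n$ be a positive integer and $1\le k\le \lfloor\frac{n+1}{2}\rfloor-2$. Then $$W_{n,k+2}(x)=\left(a(n,k)x+b(n,k)\right)W_{n,k+1}(x)-c(n,k)W_{n,k}(x),$$ where $W_{n,k}(x)=\sum_{m=0}^{k}w_{n,k,m}x^m$ and $a(n,k)=\frac{(n-k)(n-2k-2)(n-2k-3)}{(k+1)(k+2)(n-k-2)}$, $b(n,k)=\frac{2(n-k)(n-k-1)(n-2k-2)}{(k+2)(n-k-2)(n-2k-1)}$, $c(n,k)=\frac{(n-k+1)(n-k)^{2}(n-2k-3)}{(k+1)(k+2)(n-k-2)(n-2k-1)}$.
   Context: For integers $n,k,m$ (with $k\ge1$) define $w_{n,k,m}=\frac{1}{k}\binom{n}{k-1}\binom{n-k-1}{m-1}\binom{k}{m}$ if $0<m\le k$ and $k+m\le n$; $w_{n,k,m}=1$ if $m=0$ and $n=k$; and $w_{n,k,m}=0$ otherwise. (Combinatorially, $w_{n,k,m}$ is the number of Dyck paths of semilength $n$ with $k$ occurrences of $UD$ and $m$ occurrences of $UUD$.) -}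

module Defs where

open import Data.Nat as ℕ using (ℕ; zero; suc; _∸_; _≤?_; _≟_)
open import Data.Nat.Combinatorics using (_C_)
open import Data.Integer as ℤ using (ℤ; +_)
open import Data.Rational using (ℚ; 0ℚ; 1ℚ; _+_; _*_; _/_)
open import Data.Bool using (if_then_else_; _∧_)
open import Relation.Nullary.Decidable using (⌊_⌋)

-- p / d as a rational; returns 0 when d = 0 (never used in that case below)
frac : ℤ → ℕ → ℚ
frac p zero    = 0ℚ
frac p (suc d) = p / suc d

pow : ℚ → ℕ → ℚ
pow x zero    = 1ℚ
pow x (suc m) = x * pow x m

w : ℕ → ℕ → ℕ → ℚ
w n k zero    = if ⌊ n ≟ k ⌋ then 1ℚ else 0ℚ
w n k (suc j) =
  if ⌊ suc j ≤? k ⌋ ∧ ⌊ k ℕ.+ suc j ≤? n ⌋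
  then frac (+ ((n C (k ∸ 1)) ℕ.* ((n ∸ k ∸ 1) C j) ℕ.* (k C suc j))) k
  else 0ℚ

sumTo : ℕ → (ℕ → ℚ) → ℚ
sumTo zero    f = f 0
sumTo (suc t) f = sumTo t f + f (suc t)

W : ℕ → ℕ → ℚ → ℚ
W n k x = sumTo k (λ m → w n k m * pow x m)

i : ℕ → ℤ
i = +_

a : ℕ → ℕ → ℚ
a n k = frac ((i n ℤ.- i k) ℤ.* (i n ℤ.- i (2 ℕ.* k) ℤ.- + 2) ℤ.* (i n ℤ.- i (2 ℕ.* k) ℤ.- + 3))
             ((k ℕ.+ 1) ℕ.* (k ℕ.+ 2) ℕ.* (n ∸ k ∸ 2))

b : ℕ → ℕ → ℚ
b n k = frac (+ 2 ℤ.* (i n ℤ.- i k) ℤ.* (i n ℤ.- i k ℤ.- + 1) ℤ.* (i n ℤ.- i (2 ℕ.* k) ℤ.- + 2))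
             ((k ℕ.+ 2) ℕ.* (n ∸ k ∸ 2) ℕ.* (n ∸ 2 ℕ.* k ∸ 1))

c : ℕ → ℕ → ℚ
c n k = frac ((i n ℤ.- i k ℤ.+ + 1) ℤ.* (i n ℤ.- i k) ℤ.* (i n ℤ.- i k) ℤ.* (i n ℤ.- i (2 ℕ.* k) ℤ.- + 3))
             ((k ℕ.+ 1) ℕ.* (k ℕ.+ 2) ℕ.* (n ∸ k ∸ 2) ℕ.* (n ∸ 2 ℕ.* k ∸ 1))

-- Compare coefficients of x^m. For m ≥ 1 and K ≥ 1 we have
-- K·w(n,K,m) = C(n,K-1)·C(n-K-1,m-1)·C(K,m), so once the denominators of a, b, c
-- are cleared and C(n,k+1), C(n,k) are traded for multiples of C(n,k-1), the
-- coefficient of x^m becomes an identity between four products of two binomial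
-- coefficients. Writing n = 2k+3+r and m = t+2, absorption identities turn each
-- product into C(n-k-3,t)·C(k,t+1) times a rational function of k, r, t, leaving a
-- polynomial identity; the cases t = k, m = 1 and m = 0 degenerate and are checked
-- directly.

module Submission where

open import Defs

module Fractions where

  open import Data.Nat as ℕ using (ℕ; suc)
  open import Data.Nat.Coprimality using (1-coprimeTo) renaming (sym to coprime-sym)
  open import Data.Integer as ℤ using (+_)
  import Data.Integer.Properties as ℤ
  import Data.Nat.Properties as ℕ
  open import Data.Integer.Solver using (module +-*-Solver)
  open import Data.Rational using (ℚ; mkℚ; 0ℚ; 1ℚ; _+_; _*_; _-_; 1/_; toℚᵘ; NonZero)
  open import Data.Rational.Properties
  import Data.Rational.Unnormalised as ℚᵘ
  import Data.Rational.Unnormalised.Properties as ℚᵘ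
  open import Data.Rational.Solver renaming (module +-*-Solver to ℚ-Solver)
  open import Relation.Binary.PropositionalEquality

  fromℕ : ℕ → ℚ
  fromℕ m = mkℚ (+ m) 0 (coprime-sym (1-coprimeTo m))

  fromℕ-+ : ∀ m n → fromℕ (m ℕ.+ n) ≡ fromℕ m + fromℕ n
  fromℕ-+ m n = toℚᵘ-injective (ℚᵘ.≃-sym (ℚᵘ.≃-trans (toℚᵘ-homo-+ (fromℕ m) (fromℕ n)) (ℚᵘ.*≡* eq)))
    where
    open +-*-Solver
    eq : (+ m ℤ.* + 1 ℤ.+ + n ℤ.* + 1) ℤ.* + 1 ≡ + (m ℕ.+ n) ℤ.* + 1
    eq = solve 2 (λ m n → (m :* con (+ 1) :+ n :* con (+ 1)) :* con (+ 1) := (m :+ n) :* con (+ 1)) refl (+ m) (+ n)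

  fromℕ-* : ∀ m n → fromℕ (m ℕ.* n) ≡ fromℕ m * fromℕ n
  fromℕ-* m n = toℚᵘ-injective (ℚᵘ.≃-sym (ℚᵘ.≃-trans (toℚᵘ-homo-* (fromℕ m) (fromℕ n)) (ℚᵘ.*≡* eq)))
    where
    eq : (+ m ℤ.* + n) ℤ.* + 1 ≡ + (m ℕ.* n) ℤ.* + 1
    eq = cong (ℤ._* + 1) (sym (ℤ.pos-* m n))

  *-cancelʳ : ∀ {X Y} Q .{{_ : NonZero Q}} → X * Q ≡ Y * Q → X ≡ Y
  *-cancelʳ {X} {Y} Q eq = begin
    X                ≡⟨ *-identityʳ X ⟨
    X * 1ℚ           ≡⟨ cong (X *_) (*-inverseʳ Q) ⟨
    X * (Q * 1/ Q)   ≡⟨ *-assoc X Q (1/ Q) ⟨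
    X * Q * 1/ Q     ≡⟨ cong (_* 1/ Q) eq ⟩
    Y * Q * 1/ Q     ≡⟨ *-assoc Y Q (1/ Q) ⟩
    Y * (Q * 1/ Q)   ≡⟨ cong (Y *_) (*-inverseʳ Q) ⟩
    Y * 1ℚ           ≡⟨ *-identityʳ Y ⟩
    Y                ∎
    where open ≡-Reasoning

  infix 4 _≐_/_

  -- A record rather than a bare equation, so that N and D are inferable from the type.
  record _≐_/_ (X : ℚ) (N D : ℕ) : Set where
    constructor cleared
    field denominator-cleared : X * fromℕ D ≡ fromℕ N

  frac-≐ : ∀ {z N D D′} .{{_ : ℕ.NonZero D′}} → z ≡ + N → D ≡ D′ → frac z D ≐ N / D′
  frac-≐ {N = N} {D′ = suc d} refl refl =
    cleared (toℚᵘ-injective (ℚᵘ.≃-trans (toℚᵘ-homo-* (frac (+ N) (suc d)) (fromℕ (suc d)))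
      (ℚᵘ.≃-trans (ℚᵘ.*-congʳ (toℚᵘ-fromℚᵘ (ℚᵘ.mkℚᵘ (+ N) d))) (ℚᵘ.*≡* eq))))
    where
    eq : (+ N ℤ.* + suc d) ℤ.* + 1 ≡ + N ℤ.* + (suc d ℕ.* 1)
    eq = trans (ℤ.*-identityʳ _) (cong (λ z → + N ℤ.* + z) (sym (ℕ.*-identityʳ (suc d))))

  ≐-* : ∀ {X Y N M D E} → X ≐ N / D → Y ≐ M / E → X * Y ≐ N ℕ.* M / D ℕ.* E
  ≐-* {X} {Y} {N} {M} {D} {E} (cleared x) (cleared y) = cleared (begin
    X * Y * fromℕ (D ℕ.* E)            ≡⟨ cong (X * Y *_) (fromℕ-* D E) ⟩
    X * Y * (fromℕ D * fromℕ E)        ≡⟨ solve 4 (λ X Y D E → X :* Y :* (D :* E) := (X :* D) :* (Y :* E)) refl X Y (fromℕ D) (fromℕ E) ⟩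
    (X * fromℕ D) * (Y * fromℕ E)      ≡⟨ cong₂ _*_ x y ⟩
    fromℕ N * fromℕ M                  ≡⟨ fromℕ-* N M ⟨
    fromℕ (N ℕ.* M)                    ∎)
    where
    open ≡-Reasoning
    open ℚ-Solver

  ≐-rescale : ∀ {X N D} e {L} → X ≐ N / D → L ≡ e ℕ.* D → X ≐ e ℕ.* N / L
  ≐-rescale {X} {N} {D} e {L} (cleared x) refl = cleared (begin
    X * fromℕ (e ℕ.* D)        ≡⟨ cong (X *_) (fromℕ-* e D) ⟩
    X * (fromℕ e * fromℕ D)    ≡⟨ solve 3 (λ X e D → X :* (e :* D) := e :* (X :* D)) refl X (fromℕ e) (fromℕ D) ⟩
    fromℕ e * (X * fromℕ D)    ≡⟨ cong (fromℕ e *_) x ⟩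
    fromℕ e * fromℕ N          ≡⟨ fromℕ-* e N ⟨
    fromℕ (e ℕ.* N)            ∎)
    where
    open ≡-Reasoning
    open ℚ-Solver

  ≐-combination : ∀ {X Y Y′ Z N₂ N₁ N₁′ N₀} D .{{_ : ℕ.NonZero D}} →
                  X ≐ N₂ / D → Y ≐ N₁ / D → Y′ ≐ N₁′ / D → Z ≐ N₀ / D →
                  N₂ ℕ.+ N₀ ≡ N₁ ℕ.+ N₁′ → X ≡ Y + Y′ - Z
  ≐-combination {X} {Y} {Y′} {Z} {N₂} {N₁} {N₁′} {N₀} (suc d) (cleared x) (cleared y) (cleared y′) (cleared z) numerators =
    *-cancelʳ D (begin
      X * D                            ≡⟨ x ⟩
      fromℕ N₂                         ≡⟨ solve 2 (λ a b → a := a :+ b :- b) refl (fromℕ N₂) (fromℕ N₀) ⟩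
      fromℕ N₂ + fromℕ N₀ - fromℕ N₀   ≡⟨ cong (_- fromℕ N₀) (fromℕ-+ N₂ N₀) ⟨
      fromℕ (N₂ ℕ.+ N₀) - fromℕ N₀     ≡⟨ cong (λ m → fromℕ m - fromℕ N₀) numerators ⟩
      fromℕ (N₁ ℕ.+ N₁′) - fromℕ N₀    ≡⟨ cong (_- fromℕ N₀) (fromℕ-+ N₁ N₁′) ⟩
      fromℕ N₁ + fromℕ N₁′ - fromℕ N₀  ≡⟨ cong₂ _-_ (cong₂ _+_ y y′) z ⟨
      Y * D + Y′ * D - Z * D           ≡⟨ solve 4 (λ Y Y′ Z D → Y :* D :+ Y′ :* D :- Z :* D := (Y :+ Y′ :- Z) :* D) refl Y Y′ Z D ⟩
      (Y + Y′ - Z) * D                 ∎)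
    where
    open ≡-Reasoning
    open ℚ-Solver
    D = fromℕ (suc d)

  ≐-zero : ∀ {X N} D → X ≡ 0ℚ → N ≡ 0 → X ≐ N / D
  ≐-zero D refl refl = cleared (*-zeroˡ (fromℕ D))

module Polynomials where

  open import Data.Nat as ℕ using (ℕ; zero; suc; z≤n)
  import Data.Nat.Properties as ℕ
  open import Data.Rational using (ℚ; 0ℚ; 1ℚ; _+_; _*_; _-_)
  open import Data.Rational.Properties
  open import Data.Rational.Solver renaming (module +-*-Solver to ℚ-Solver)
  open import Relation.Binary.PropositionalEquality

  sumTo-cong : ∀ t {f g} → (∀ m → m ℕ.≤ t → f m ≡ g m) → sumTo t f ≡ sumTo t g
  sumTo-cong zero    f≗g = f≗g 0 z≤n
  sumTo-cong (suc t) f≗g =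
    cong₂ _+_ (sumTo-cong t (λ m m≤t → f≗g m (ℕ.m≤n⇒m≤1+n m≤t))) (f≗g (suc t) ℕ.≤-refl)

  sumTo-scale : ∀ t A f → sumTo t (λ m → A * f m) ≡ A * sumTo t f
  sumTo-scale zero    A f = refl
  sumTo-scale (suc t) A f = trans (cong (_+ A * f (suc t)) (sumTo-scale t A f))
                                  (sym (*-distribˡ-+ A (sumTo t f) (f (suc t))))

  sumTo-linear : ∀ t A B C f g h →
                 sumTo t (λ m → A * f m + B * g m - C * h m) ≡ A * sumTo t f + B * sumTo t g - C * sumTo t h
  sumTo-linear zero    A B C f g h = refl
  sumTo-linear (suc t) A B C f g h = begin
    sumTo t (λ m → A * f m + B * g m - C * h m) + (A * f t′ + B * g t′ - C * h t′)
      ≡⟨ cong (_+ (A * f t′ + B * g t′ - C * h t′)) (sumTo-linear t A B C f g h) ⟩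
    A * sumTo t f + B * sumTo t g - C * sumTo t h + (A * f t′ + B * g t′ - C * h t′)
      ≡⟨ solve 9 (λ A B C F G H f g h → A :* F :+ B :* G :- C :* H :+ (A :* f :+ B :* g :- C :* h)
                    := A :* (F :+ f) :+ B :* (G :+ g) :- C :* (H :+ h))
               refl A B C (sumTo t f) (sumTo t g) (sumTo t h) (f t′) (g t′) (h t′) ⟩
    A * sumTo (suc t) f + B * sumTo (suc t) g - C * sumTo (suc t) h ∎
    where
    open ≡-Reasoning
    open ℚ-Solver using (solve; _:+_; _:*_; _:-_; _:=_)
    t′ = suc t

  sumTo-head : ∀ t f → sumTo (suc t) f ≡ f 0 + sumTo t (λ m → f (suc m))
  sumTo-head zero    f = refl
  sumTo-head (suc t) f = trans (cong (_+ f (suc (suc t))) (sumTo-head t f)) (+-assoc (f 0) _ _)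

  sumTo-extend-zero : ∀ t f → f (suc t) ≡ 0ℚ → sumTo (suc t) f ≡ sumTo t f
  sumTo-extend-zero t f f[1+t]≡0 = trans (cong (sumTo t f +_) f[1+t]≡0) (+-identityʳ _)

  poly : ℕ → (ℕ → ℚ) → ℚ → ℚ
  poly t f x = sumTo t (λ m → f m * pow x m)

  shift : (ℕ → ℚ) → ℕ → ℚ
  shift f zero    = 0ℚ
  shift f (suc m) = f m

  poly-extend-zero : ∀ t f x → f (suc t) ≡ 0ℚ → poly (suc t) f x ≡ poly t f x
  poly-extend-zero t f x f[1+t]≡0 =
    sumTo-extend-zero t _ (trans (cong (_* pow x (suc t)) f[1+t]≡0) (*-zeroˡ (pow x (suc t))))

  x*poly≡poly-shift : ∀ t f x → x * poly t f x ≡ poly (suc t) (shift f) x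
  x*poly≡poly-shift t f x = begin
    x * poly t f x                                        ≡⟨ sumTo-scale t x _ ⟨
    sumTo t (λ m → x * (f m * pow x m))                   ≡⟨ sumTo-cong t (λ m _ → solve 3 (λ x c p → x :* (c :* p) := c :* (x :* p)) refl x (f m) (pow x m)) ⟩
    sumTo t (λ m → f m * pow x (suc m))                   ≡⟨ solve 1 (λ s → s := con 0ℚ :* con 1ℚ :+ s) refl _ ⟩
    0ℚ * 1ℚ + sumTo t (λ m → f m * pow x (suc m))         ≡⟨ sumTo-head t _ ⟨
    poly (suc t) (shift f) x                              ∎
    where
    open ≡-Reasoning
    open ℚ-Solver using (solve; _:+_; _:*_; _:=_; con)

  poly-three-term : ∀ K x A B C (f₂ f₁ f₀ : ℕ → ℚ) →
    (∀ m → m ℕ.≤ suc (suc K) → f₂ m ≡ A * shift f₁ m + B * f₁ m - C * f₀ m) →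
    f₁ (suc (suc K)) ≡ 0ℚ → f₀ (suc K) ≡ 0ℚ → f₀ (suc (suc K)) ≡ 0ℚ →
    poly (suc (suc K)) f₂ x ≡ (A * x + B) * poly (suc K) f₁ x - C * poly K f₀ x
  poly-three-term K x A B C f₂ f₁ f₀ recurrence f₁-top f₀-top f₀-top′ = begin
    poly K₂ f₂ x
      ≡⟨ sumTo-cong K₂ (λ m m≤K₂ → trans (cong (_* pow x m) (recurrence m m≤K₂)) (distribute m)) ⟩
    sumTo K₂ (λ m → A * (shift f₁ m * pow x m) + B * (f₁ m * pow x m) - C * (f₀ m * pow x m))
      ≡⟨ sumTo-linear K₂ A B C _ _ _ ⟩
    A * poly K₂ (shift f₁) x + B * poly K₂ f₁ x - C * poly K₂ f₀ x
      ≡⟨ cong₂ (λ u v → A * u + B * v - C * poly K₂ f₀ x)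
               (sym (x*poly≡poly-shift (suc K) f₁ x)) (poly-extend-zero (suc K) f₁ x f₁-top) ⟩
    A * (x * poly (suc K) f₁ x) + B * poly (suc K) f₁ x - C * poly K₂ f₀ x
      ≡⟨ cong (λ u → A * (x * poly (suc K) f₁ x) + B * poly (suc K) f₁ x - C * u)
              (trans (poly-extend-zero (suc K) f₀ x f₀-top′) (poly-extend-zero K f₀ x f₀-top)) ⟩
    A * (x * poly (suc K) f₁ x) + B * poly (suc K) f₁ x - C * poly K f₀ x
      ≡⟨ solve 6 (λ A B C x P Q → A :* (x :* P) :+ B :* P :- C :* Q := (A :* x :+ B) :* P :- C :* Q)
               refl A B C x (poly (suc K) f₁ x) (poly K f₀ x) ⟩
    (A * x + B) * poly (suc K) f₁ x - C * poly K f₀ x ∎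
    where
    open ≡-Reasoning
    open ℚ-Solver using (solve; _:+_; _:*_; _:-_; _:=_)
    K₂ = suc (suc K)
    distribute : ∀ m → (A * shift f₁ m + B * f₁ m - C * f₀ m) * pow x m
                     ≡ A * (shift f₁ m * pow x m) + B * (f₁ m * pow x m) - C * (f₀ m * pow x m)
    distribute m = solve 7 (λ A B C u v w p → (A :* u :+ B :* v :- C :* w) :* p
                                            := A :* (u :* p) :+ B :* (v :* p) :- C :* (w :* p))
                         refl A B C (shift f₁ m) (f₁ m) (f₀ m) (pow x m)

module Binomials where

  open import Data.Nat
  open import Data.Nat.Properties
  open import Data.Nat.Combinatorics using (_C_; nCk+nC[k+1]≡[n+1]C[k+1]; k>n⇒nCk≡0)
  open import Data.Nat.Solver using (module +-*-Solver)
  open import Data.Sum using (inj₁; inj₂)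
  open import Relation.Binary.PropositionalEquality
  open +-*-Solver

  -- Unlike _C_, which is defined through factorials, this computes by Pascal's rule.
  choose : ℕ → ℕ → ℕ
  choose n       zero    = 1
  choose zero    (suc k) = 0
  choose (suc n) (suc k) = choose n k + choose n (suc k)

  nCk≡choose : ∀ n k → n C k ≡ choose n k
  nCk≡choose n       zero    = refl
  nCk≡choose zero    (suc k) = k>n⇒nCk≡0 {0} {suc k} (s≤s z≤n)
  nCk≡choose (suc n) (suc k) =
    trans (sym (nCk+nC[k+1]≡[n+1]C[k+1] n k)) (cong₂ _+_ (nCk≡choose n k) (nCk≡choose n (suc k)))

  choose-vanish : ∀ n k → n < k → choose n k ≡ 0
  choose-vanish zero    (suc k) _         = refl
  choose-vanish (suc n) (suc k) (s≤s n<k) =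
    cong₂ _+_ (choose-vanish n k n<k) (choose-vanish n (suc k) (m<n⇒m<1+n n<k))

  choose-diag : ∀ n → choose n n ≡ 1
  choose-diag zero    = refl
  choose-diag (suc n) = cong₂ _+_ (choose-diag n) (choose-vanish n (suc n) ≤-refl)

  choose-1 : ∀ n → choose n 1 ≡ n
  choose-1 zero    = refl
  choose-1 (suc n) = cong suc (choose-1 n)

  choose-absorption : ∀ n k → choose (suc n) (suc k) * suc k ≡ suc n * choose n k
  choose-absorption zero     zero     = refl
  choose-absorption zero     (suc k)  = refl
  choose-absorption (suc n)  zero     =
    trans (*-identityʳ _) (trans (cong suc (choose-1 (suc n))) (sym (*-identityʳ _)))
  choose-absorption (suc n′) (suc k′) = begin
    (X + Y) * suc (suc k′)
      ≡⟨ solve 3 (λ X Y k → (X :+ Y) :* (con 2 :+ k) := X :* (con 1 :+ k) :+ X :+ Y :* (con 2 :+ k)) refl X Y k′ ⟩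
    X * suc k′ + X + Y * suc (suc k′)
      ≡⟨ cong₂ (λ a b → a + X + b) (choose-absorption n′ k′) (choose-absorption n′ (suc k′)) ⟩
    n * u + (u + v) + n * v
      ≡⟨ solve 3 (λ n u v → n :* u :+ (u :+ v) :+ n :* v := (con 1 :+ n) :* (u :+ v)) refl n u v ⟩
    suc n * (u + v) ∎
    where
    open ≡-Reasoning
    n = suc n′
    X = choose n (suc k′)
    Y = choose n (suc (suc k′))
    u = choose n′ k′
    v = choose n′ (suc k′)

  choose-step-lower : ∀ m d → choose (m + d) (suc m) * suc m ≡ choose (m + d) m * d
  choose-step-lower m d = +-cancelˡ-≡ (N m * suc m) _ _ (begin
    N m * suc m + N (suc m) * suc m    ≡⟨ *-distribʳ-+ (suc m) (N m) _ ⟨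
    choose (suc (m + d)) (suc m) * suc m  ≡⟨ choose-absorption (m + d) m ⟩
    suc (m + d) * N m                  ≡⟨ solve 3 (λ m d b → (con 1 :+ (m :+ d)) :* b := b :* (con 1 :+ m) :+ b :* d) refl m d (N m) ⟩
    N m * suc m + N m * d              ∎)
    where
    open ≡-Reasoning
    N = choose (m + d)

  choose-step-upper : ∀ m d → choose (suc (m + d)) m * suc d ≡ choose (m + d) m * suc (m + d)
  choose-step-upper zero    d = refl
  choose-step-upper (suc m) d = *-cancelʳ-≡ _ _ (suc m) (begin
    choose (suc N) (suc m) * suc d * suc m
      ≡⟨ solve 3 (λ a b c → a :* b :* c := a :* c :* b) refl (choose (suc N) (suc m)) (suc d) (suc m) ⟩
    choose (suc N) (suc m) * suc m * suc d
      ≡⟨ cong (_* suc d) (choose-absorption N m) ⟩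
    suc N * choose N m * suc d
      ≡⟨ solve 3 (λ a b c → a :* b :* c := b :* c :* a) refl (suc N) (choose N m) (suc d) ⟩
    choose N m * suc d * suc N
      ≡⟨ cong (_* suc N) lower ⟨
    choose N (suc m) * suc m * suc N
      ≡⟨ solve 3 (λ a b c → a :* b :* c := a :* c :* b) refl (choose N (suc m)) (suc m) (suc N) ⟩
    choose N (suc m) * suc N * suc m ∎)
    where
    open ≡-Reasoning
    N = suc m + d
    lower : choose N (suc m) * suc m ≡ choose N m * suc d
    lower = subst (λ z → choose z (suc m) * suc m ≡ choose z m * suc d) (+-suc m d) (choose-step-lower m (suc d))

  choose-step-both : ∀ m d → choose (2 + (m + d)) (suc m) * (suc m * suc d) ≡ choose (m + d) m * ((2 + (m + d)) * suc (m + d))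
  choose-step-both m d = begin
    choose (2 + N) (suc m) * (suc m * suc d)      ≡⟨ *-assoc (choose (2 + N) (suc m)) (suc m) (suc d) ⟨
    choose (2 + N) (suc m) * suc m * suc d        ≡⟨ cong (_* suc d) (choose-absorption (suc N) m) ⟩
    (2 + N) * choose (suc N) m * suc d            ≡⟨ *-assoc (2 + N) (choose (suc N) m) (suc d) ⟩
    (2 + N) * (choose (suc N) m * suc d)          ≡⟨ cong ((2 + N) *_) (choose-step-upper m d) ⟩
    (2 + N) * (choose N m * suc N)                ≡⟨ solve 3 (λ a b c → a :* (b :* c) := b :* (a :* c)) refl (2 + N) (choose N m) (suc N) ⟩
    choose N m * ((2 + N) * suc N)                ∎
    where
    open ≡-Reasoning
    N = m + d

  c₂ c₀ c₁′ c₁ : ℕ → ℕ → ℕ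
  c₂  k r = suc k * (suc k + r) * (2 + r)
  c₀  k r = suc k * (3 + k + r) * r
  c₁′ k r = (2 + r) * (1 + r) * r
  c₁  k r = 2 * suc k * (2 + k + r) * (1 + r)

  -- The coefficient of x^(t+2) in the recurrence with denominators cleared; p = n - k - 3.
  BinomialIdentity : ℕ → ℕ → ℕ → ℕ → Set
  BinomialIdentity k p r t =
    c₂ k r * (choose p (suc t) * choose (2 + k) (2 + t)) + c₀ k r * (choose (2 + p) (suc t) * choose k (2 + t))
    ≡ c₁′ k r * (choose (suc p) t * choose (suc k) (suc t)) + c₁ k r * (choose (suc p) (suc t) * choose (suc k) (2 + t))

  -- With k = t + s + 1, absorption writes each product of binomials as X·Y times a
  -- rational function of t, s, r; M clears all of their denominators.
  binomial-identity-below : ∀ t s r → BinomialIdentity (suc (t + s)) (t + suc (s + r)) r t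
  binomial-identity-below t s r = *-cancelˡ-≡ _ _ M (begin
    M * (c₂ k r * T₂ + c₀ k r * T₀)                    ≡⟨ distribute M (c₂ k r) T₂ (c₀ k r) T₀ ⟩
    c₂ k r * (M * T₂) + c₀ k r * (M * T₀)              ≡⟨ cong₂ (λ x y → c₂ k r * x + c₀ k r * y) MT₂ MT₀ ⟩
    c₂ k r * (X * Y * P₂) + c₀ k r * (X * Y * P₀)      ≡⟨ polynomial-identity ⟩
    c₁′ k r * (X * Y * P₁′) + c₁ k r * (X * Y * P₁)    ≡⟨ cong₂ (λ x y → c₁′ k r * x + c₁ k r * y) MT₁′ MT₁ ⟨
    c₁′ k r * (M * T₁′) + c₁ k r * (M * T₁)            ≡⟨ distribute M (c₁′ k r) T₁′ (c₁ k r) T₁ ⟨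
    M * (c₁′ k r * T₁′ + c₁ k r * T₁)                  ∎)
    where
    open ≡-Reasoning
    k = suc (t + s)
    p = t + suc (s + r)
    X = choose p t
    Y = choose k (suc t)
    M = suc t * suc (suc t) * suc (suc (s + r)) * suc s
    T₂  = choose p (suc t) * choose (2 + k) (2 + t)
    T₀  = choose (2 + p) (suc t) * choose k (2 + t)
    T₁′ = choose (suc p) t * choose (suc k) (suc t)
    T₁  = choose (suc p) (suc t) * choose (suc k) (2 + t)
    P₂  = suc (s + r) * ((2 + k) * suc k) * suc (suc (s + r))
    P₀  = (2 + p) * suc p * s * suc s
    P₁′ = suc p * suc k * (suc t * suc (suc t))
    P₁  = suc p * suc k * (suc (suc (s + r)) * suc s)

    scaled-product : ∀ {α β} u v a b c → M ≡ a * b * c → u * a ≡ X * α → v * b ≡ Y * β →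
                     M * (u * v) ≡ X * Y * (α * β * c)
    scaled-product {α} {β} u v a b c M≡abc ua vb = begin
      M * (u * v)                ≡⟨ cong (_* (u * v)) M≡abc ⟩
      a * b * c * (u * v)        ≡⟨ solve 5 (λ a b c u v → a :* b :* c :* (u :* v) := (u :* a) :* (v :* b) :* c) refl a b c u v ⟩
      (u * a) * (v * b) * c      ≡⟨ cong₂ (λ x y → x * y * c) ua vb ⟩
      (X * α) * (Y * β) * c      ≡⟨ solve 5 (λ X α Y β c → (X :* α) :* (Y :* β) :* c := X :* Y :* (α :* β :* c)) refl X α Y β c ⟩
      X * Y * (α * β * c)        ∎

    distribute : ∀ M a x b y → M * (a * x + b * y) ≡ a * (M * x) + b * (M * y)
    distribute = solve 5 (λ M a x b y → M :* (a :* x :+ b :* y) := a :* (M :* x) :+ b :* (M :* y)) refl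

    MT₂ : M * T₂ ≡ X * Y * P₂
    MT₂ = scaled-product (choose p (suc t)) (choose (2 + k) (2 + t)) (suc t) (suc (suc t) * suc s) (suc (suc (s + r)))
            (solve 3 (λ t s r → (con 1 :+ t) :* (con 2 :+ t) :* (con 2 :+ s :+ r) :* (con 1 :+ s)
                              := (con 1 :+ t) :* ((con 2 :+ t) :* (con 1 :+ s)) :* (con 2 :+ s :+ r)) refl t s r)
            (choose-step-lower t (suc (s + r))) (choose-step-both (suc t) s)

    MT₀ : M * T₀ ≡ X * Y * P₀
    MT₀ = scaled-product (choose (2 + p) (suc t)) (choose k (2 + t)) (suc t * suc (suc (s + r))) (suc (suc t)) (suc s)
            (solve 3 (λ t s r → (con 1 :+ t) :* (con 2 :+ t) :* (con 2 :+ s :+ r) :* (con 1 :+ s)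
                              := (con 1 :+ t) :* (con 2 :+ s :+ r) :* (con 2 :+ t) :* (con 1 :+ s)) refl t s r)
            (choose-step-both t (suc (s + r))) (choose-step-lower (suc t) s)

    MT₁′ : M * T₁′ ≡ X * Y * P₁′
    MT₁′ = scaled-product (choose (suc p) t) (choose (suc k) (suc t)) (suc (suc (s + r))) (suc s) (suc t * suc (suc t))
             (solve 3 (λ t s r → (con 1 :+ t) :* (con 2 :+ t) :* (con 2 :+ s :+ r) :* (con 1 :+ s)
                               := (con 2 :+ s :+ r) :* (con 1 :+ s) :* ((con 1 :+ t) :* (con 2 :+ t))) refl t s r)
             (choose-step-upper t (suc (s + r))) (choose-step-upper (suc t) s)

    MT₁ : M * T₁ ≡ X * Y * P₁
    MT₁ = scaled-product (choose (suc p) (suc t)) (choose (suc k) (2 + t)) (suc t) (suc (suc t)) (suc (suc (s + r)) * suc s)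
            (solve 3 (λ t s r → (con 1 :+ t) :* (con 2 :+ t) :* (con 2 :+ s :+ r) :* (con 1 :+ s)
                              := (con 1 :+ t) :* (con 2 :+ t) :* ((con 2 :+ s :+ r) :* (con 1 :+ s))) refl t s r)
            (trans (choose-absorption p t) (*-comm (suc p) X)) (trans (choose-absorption k (suc t)) (*-comm (suc k) Y))

    polynomial-identity : c₂ k r * (X * Y * P₂) + c₀ k r * (X * Y * P₀) ≡ c₁′ k r * (X * Y * P₁′) + c₁ k r * (X * Y * P₁)
    polynomial-identity = solve 5 (λ t s r X Y →
      let k = con 1 :+ t :+ s ; p = t :+ (con 1 :+ s :+ r) in
          (con 1 :+ k) :* (con 1 :+ k :+ r) :* (con 2 :+ r) :* (X :* Y :* ((con 1 :+ s :+ r) :* ((con 2 :+ k) :* (con 1 :+ k)) :* (con 2 :+ s :+ r)))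
       :+ (con 1 :+ k) :* (con 3 :+ k :+ r) :* r :* (X :* Y :* ((con 2 :+ p) :* (con 1 :+ p) :* s :* (con 1 :+ s)))
       := (con 2 :+ r) :* (con 1 :+ r) :* r :* (X :* Y :* ((con 1 :+ p) :* (con 1 :+ k) :* ((con 1 :+ t) :* (con 2 :+ t))))
       :+ con 2 :* (con 1 :+ k) :* (con 2 :+ k :+ r) :* (con 1 :+ r) :* (X :* Y :* ((con 1 :+ p) :* (con 1 :+ k) :* ((con 2 :+ s :+ r) :* (con 1 :+ s)))))
      refl t s r X Y

  binomial-identity-diagonal : ∀ k r → BinomialIdentity k (k + r) r k
  binomial-identity-diagonal k r = begin
    c₂ k r * (A * choose (2 + k) (2 + k)) + c₀ k r * (Z * choose k (2 + k))
      ≡⟨ cong₂ (λ x y → c₂ k r * (A * x) + c₀ k r * (Z * y))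
               (choose-diag (2 + k)) (choose-vanish k (2 + k) (m<n⇒m<1+n (n<1+n k))) ⟩
    c₂ k r * (A * 1) + c₀ k r * (Z * 0)
      ≡⟨ solve 4 (λ c A c′ Z → c :* (A :* con 1) :+ c′ :* (Z :* con 0) := c :* A) refl (c₂ k r) A (c₀ k r) Z ⟩
    c₂ k r * A
      ≡⟨ *-cancelˡ-≡ _ _ (suc k * suc r) scaled ⟩
    c₁′ k r * B
      ≡⟨ solve 4 (λ c B c′ D → c :* B := c :* (B :* con 1) :+ c′ :* (D :* con 0)) refl (c₁′ k r) B (c₁ k r) D ⟩
    c₁′ k r * (B * 1) + c₁ k r * (D * 0)
      ≡⟨ cong₂ (λ x y → c₁′ k r * (B * x) + c₁ k r * (D * y))
               (choose-diag (suc k)) (choose-vanish (suc k) (2 + k) (n<1+n (suc k))) ⟨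
    c₁′ k r * (B * choose (suc k) (suc k)) + c₁ k r * (D * choose (suc k) (2 + k)) ∎
    where
    open ≡-Reasoning
    p = k + r
    A = choose p (suc k)
    B = choose (suc p) k
    D = choose (suc p) (suc k)
    E = choose p k
    Z = choose (2 + p) (suc k)
    scaled : suc k * suc r * (c₂ k r * A) ≡ suc k * suc r * (c₁′ k r * B)
    scaled = begin
      suc k * suc r * (c₂ k r * A)    ≡⟨ solve 4 (λ k r c A → (con 1 :+ k) :* (con 1 :+ r) :* (c :* A) := c :* (con 1 :+ r) :* (A :* (con 1 :+ k))) refl k r (c₂ k r) A ⟩
      c₂ k r * suc r * (A * suc k)    ≡⟨ cong (c₂ k r * suc r *_) (choose-step-lower k r) ⟩
      c₂ k r * suc r * (E * r)        ≡⟨ solve 3 (λ k r E → (con 1 :+ k) :* ((con 1 :+ k) :+ r) :* (con 2 :+ r) :* (con 1 :+ r) :* (E :* r)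
                                                        := (con 2 :+ r) :* (con 1 :+ r) :* r :* (con 1 :+ k) :* (E :* (con 1 :+ (k :+ r)))) refl k r E ⟩
      c₁′ k r * suc k * (E * suc p)   ≡⟨ cong (c₁′ k r * suc k *_) (choose-step-upper k r) ⟨
      c₁′ k r * suc k * (B * suc r)   ≡⟨ solve 4 (λ k r c B → c :* (con 1 :+ k) :* (B :* (con 1 :+ r)) := (con 1 :+ k) :* (con 1 :+ r) :* (c :* B)) refl k r (c₁′ k r) B ⟩
      suc k * suc r * (c₁′ k r * B)   ∎

  binomial-identity : ∀ k r t → t ≤ k → BinomialIdentity k (k + r) r t
  binomial-identity k r t t≤k with m≤n⇒m<n∨m≡n t≤k
  ... | inj₂ refl = binomial-identity-diagonal k r
  ... | inj₁ t<k  = subst₂ (λ k p → BinomialIdentity k p r t) k≡ p≡ (binomial-identity-below t s r)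
    where
    s = k ∸ suc t
    k≡ : suc (t + s) ≡ k
    k≡ = m+[n∸m]≡n t<k
    p≡ : t + suc (s + r) ≡ k + r
    p≡ = trans (solve 3 (λ t s r → t :+ (con 1 :+ (s :+ r)) := con 1 :+ (t :+ s) :+ r) refl t s r) (cong (_+ r) k≡)

  binomial-identity-linear : ∀ k r →
    c₂ k r * (1 * choose (2 + k) 1) + c₀ k r * (1 * choose k 1) ≡ c₁′ k r * 0 + c₁ k r * (1 * choose (suc k) 1)
  binomial-identity-linear k r = begin
    c₂ k r * (1 * choose (2 + k) 1) + c₀ k r * (1 * choose k 1)
      ≡⟨ cong₂ (λ x y → c₂ k r * (1 * x) + c₀ k r * (1 * y)) (choose-1 (2 + k)) (choose-1 k) ⟩
    c₂ k r * (1 * (2 + k)) + c₀ k r * (1 * k)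
      ≡⟨ solve 2 (λ k r → (con 1 :+ k) :* ((con 1 :+ k) :+ r) :* (con 2 :+ r) :* (con 1 :* (con 2 :+ k)) :+ (con 1 :+ k) :* (con 3 :+ k :+ r) :* r :* (con 1 :* k)
                       := (con 2 :+ r) :* (con 1 :+ r) :* r :* con 0 :+ con 2 :* (con 1 :+ k) :* (con 2 :+ k :+ r) :* (con 1 :+ r) :* (con 1 :* (con 1 :+ k))) refl k r ⟩
    c₁′ k r * 0 + c₁ k r * (1 * suc k)
      ≡⟨ cong (λ x → c₁′ k r * 0 + c₁ k r * (1 * x)) (choose-1 (suc k)) ⟨
    c₁′ k r * 0 + c₁ k r * (1 * choose (suc k) 1) ∎
    where open ≡-Reasoning

module Coefficients where

  open Fractions
  open Polynomials
  open Binomials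

  open import Data.Nat as ℕ using (ℕ; zero; suc; _∸_; _≤?_; _≟_; s≤s)
  import Data.Nat.Properties as ℕ
  open import Data.Nat.Combinatorics using (_C_)
  open import Data.Nat.Solver renaming (module +-*-Solver to ℕ-Solver)
  open import Data.Integer as ℤ using (+_)
  import Data.Integer.Properties as ℤ
  open import Data.Integer.Solver renaming (module +-*-Solver to ℤ-Solver)
  open import Data.Rational using (ℚ; 0ℚ; _+_; _*_; _-_)
  open import Relation.Nullary using (yes; no)
  open import Relation.Nullary.Negation using (contradiction)
  open import Relation.Binary.PropositionalEquality

  w-above-degree : ∀ n K j → K ℕ.< suc j → w n K (suc j) ≡ 0ℚ
  w-above-degree n K j K<1+j with suc j ≤? K
  ... | yes 1+j≤K = contradiction 1+j≤K (ℕ.<⇒≱ K<1+j)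
  ... | no  _     = refl

  w-constant-term : ∀ n K → n ≢ K → w n K 0 ≡ 0ℚ
  w-constant-term n K n≢K with n ≟ K
  ... | yes n≡K = contradiction n≡K n≢K
  ... | no  _   = refl

  ∸-∸-≡ : ∀ {N} m n o → N ≡ m ℕ.+ n ℕ.+ o → N ∸ m ∸ n ≡ o
  ∸-∸-≡ m n o refl = trans (ℕ.∸-+-assoc (m ℕ.+ n ℕ.+ o) m n) (ℕ.m+n∸m≡n (m ℕ.+ n) o)

  w-≐ : ∀ n K j p → n ≡ suc K ℕ.+ 1 ℕ.+ p →
    w n (suc K) (suc j) ≐ choose n K ℕ.* (choose p j ℕ.* choose (suc K) (suc j)) / suc K
  w-≐ n K j p n≡ with suc j ≤? suc K | suc K ℕ.+ suc j ≤? n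
  ... | yes _ | yes _    = frac-≐ (cong +_ numerator) refl
    where
    N₀ = (n C K) ℕ.* ((n ∸ suc K ∸ 1) C j) ℕ.* (suc K C suc j)
    numerator : N₀ ≡ choose n K ℕ.* (choose p j ℕ.* choose (suc K) (suc j))
    numerator = begin
      (n C K) ℕ.* ((n ∸ suc K ∸ 1) C j) ℕ.* (suc K C suc j)
        ≡⟨ cong (λ m → (n C K) ℕ.* (m C j) ℕ.* (suc K C suc j)) (∸-∸-≡ (suc K) 1 p n≡) ⟩
      (n C K) ℕ.* (p C j) ℕ.* (suc K C suc j)
        ≡⟨ ℕ.*-assoc (n C K) (p C j) (suc K C suc j) ⟩
      (n C K) ℕ.* ((p C j) ℕ.* (suc K C suc j))
        ≡⟨ cong₂ ℕ._*_ (nCk≡choose n K) (cong₂ ℕ._*_ (nCk≡choose p j) (nCk≡choose (suc K) (suc j))) ⟩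
      choose n K ℕ.* (choose p j ℕ.* choose (suc K) (suc j)) ∎
      where open ≡-Reasoning
  ... | no j≰K | _       = ≐-zero (suc K) refl (trans (cong (λ z → choose n K ℕ.* (choose p j ℕ.* z)) (choose-vanish (suc K) (suc j) (ℕ.≰⇒> j≰K)))
                                                  (trans (cong (choose n K ℕ.*_) (ℕ.*-zeroʳ (choose p j))) (ℕ.*-zeroʳ (choose n K))))
  ... | yes _ | no ¬fits = ≐-zero (suc K) refl (trans (cong (λ z → choose n K ℕ.* (z ℕ.* choose (suc K) (suc j))) (choose-vanish p j p<j))
                                                  (ℕ.*-zeroʳ (choose n K)))
    where
    p<j : p ℕ.< j
    p<j = ℕ.≤-pred (ℕ.+-cancelˡ-< (suc K) (suc p) (suc j)
            (subst (ℕ._< suc K ℕ.+ suc j) (trans n≡ (ℕ.+-assoc (suc K) 1 p)) (ℕ.≰⇒> ¬fits)))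

  -- The hypothesis of the theorem says exactly that n = 2k + 3 + r for some r.
  module ThreeTerm (k′ r : ℕ) where
    k = suc k′
    p = k ℕ.+ r
    n = k ℕ.+ (3 ℕ.+ k ℕ.+ r)

    C₂ = choose n (suc k)
    C₁ = choose n k
    C₀ = choose n k′

    Na = (3 ℕ.+ k ℕ.+ r) ℕ.* (1 ℕ.+ r) ℕ.* r
    Da = (k ℕ.+ 1) ℕ.* (k ℕ.+ 2) ℕ.* suc p
    Nb = 2 ℕ.* (3 ℕ.+ k ℕ.+ r) ℕ.* (2 ℕ.+ k ℕ.+ r) ℕ.* (1 ℕ.+ r)
    Db = (k ℕ.+ 2) ℕ.* suc p ℕ.* (2 ℕ.+ r)
    Nc = (4 ℕ.+ k ℕ.+ r) ℕ.* (3 ℕ.+ k ℕ.+ r) ℕ.* (3 ℕ.+ k ℕ.+ r) ℕ.* r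
    Dc = (k ℕ.+ 1) ℕ.* (k ℕ.+ 2) ℕ.* suc p ℕ.* (2 ℕ.+ r)

    n∸k∸2 : n ∸ k ∸ 2 ≡ suc p
    n∸k∸2 = ∸-∸-≡ k 2 (suc p) (solve 2 (λ k r → k :+ (con 3 :+ k :+ r) := k :+ con 2 :+ (con 1 :+ (k :+ r))) refl k r)
      where open ℕ-Solver

    n∸2k∸1 : n ∸ 2 ℕ.* k ∸ 1 ≡ 2 ℕ.+ r
    n∸2k∸1 = ∸-∸-≡ (2 ℕ.* k) 1 (2 ℕ.+ r) (solve 2 (λ k r → k :+ (con 3 :+ k :+ r) := con 2 :* k :+ con 1 :+ (con 2 :+ r)) refl k r)
      where open ℕ-Solver

    pos-*³ : ∀ x y z → + (x ℕ.* y ℕ.* z) ≡ + x ℤ.* + y ℤ.* + z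
    pos-*³ x y z = trans (ℤ.pos-* (x ℕ.* y) z) (cong (ℤ._* + z) (ℤ.pos-* x y))

    pos-*⁴ : ∀ x y z u → + (x ℕ.* y ℕ.* z ℕ.* u) ≡ + x ℤ.* + y ℤ.* + z ℤ.* + u
    pos-*⁴ x y z u = trans (ℤ.pos-* (x ℕ.* y ℕ.* z) u) (cong (ℤ._* + u) (pos-*³ x y z))

    a-≐ : a n k ≐ Na / Da
    a-≐ = frac-≐ (trans numerator (sym (pos-*³ (3 ℕ.+ k ℕ.+ r) (1 ℕ.+ r) r))) (cong ((k ℕ.+ 1) ℕ.* (k ℕ.+ 2) ℕ.*_) n∸k∸2)
      where
      open ℤ-Solver
      numerator : (i n ℤ.- i k) ℤ.* (i n ℤ.- i (2 ℕ.* k) ℤ.- + 2) ℤ.* (i n ℤ.- i (2 ℕ.* k) ℤ.- + 3)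
                ≡ + (3 ℕ.+ k ℕ.+ r) ℤ.* + (1 ℕ.+ r) ℤ.* + r
      numerator = solve 2 (λ k r → let n = k :+ (con (+ 3) :+ k :+ r) ; 2k = k :+ (k :+ con (+ 0)) in
                    (n :- k) :* (n :- 2k :- con (+ 2)) :* (n :- 2k :- con (+ 3))
                    := (con (+ 3) :+ k :+ r) :* (con (+ 1) :+ r) :* r) refl (+ k) (+ r)

    b-≐ : b n k ≐ Nb / Db
    b-≐ = frac-≐ (trans numerator (sym (pos-*⁴ 2 (3 ℕ.+ k ℕ.+ r) (2 ℕ.+ k ℕ.+ r) (1 ℕ.+ r))))
                  (cong₂ (λ u v → (k ℕ.+ 2) ℕ.* u ℕ.* v) n∸k∸2 n∸2k∸1)
      where
      open ℤ-Solver
      numerator : + 2 ℤ.* (i n ℤ.- i k) ℤ.* (i n ℤ.- i k ℤ.- + 1) ℤ.* (i n ℤ.- i (2 ℕ.* k) ℤ.- + 2)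
                ≡ + 2 ℤ.* + (3 ℕ.+ k ℕ.+ r) ℤ.* + (2 ℕ.+ k ℕ.+ r) ℤ.* + (1 ℕ.+ r)
      numerator = solve 2 (λ k r → let n = k :+ (con (+ 3) :+ k :+ r) ; 2k = k :+ (k :+ con (+ 0)) in
                    con (+ 2) :* (n :- k) :* (n :- k :- con (+ 1)) :* (n :- 2k :- con (+ 2))
                    := con (+ 2) :* (con (+ 3) :+ k :+ r) :* (con (+ 2) :+ k :+ r) :* (con (+ 1) :+ r)) refl (+ k) (+ r)

    c-≐ : c n k ≐ Nc / Dc
    c-≐ = frac-≐ (trans numerator (sym (pos-*⁴ (4 ℕ.+ k ℕ.+ r) (3 ℕ.+ k ℕ.+ r) (3 ℕ.+ k ℕ.+ r) r)))
                  (cong₂ (λ u v → (k ℕ.+ 1) ℕ.* (k ℕ.+ 2) ℕ.* u ℕ.* v) n∸k∸2 n∸2k∸1)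
      where
      open ℤ-Solver
      numerator : (i n ℤ.- i k ℤ.+ + 1) ℤ.* (i n ℤ.- i k) ℤ.* (i n ℤ.- i k) ℤ.* (i n ℤ.- i (2 ℕ.* k) ℤ.- + 3)
                ≡ + (4 ℕ.+ k ℕ.+ r) ℤ.* + (3 ℕ.+ k ℕ.+ r) ℤ.* + (3 ℕ.+ k ℕ.+ r) ℤ.* + r
      numerator = solve 2 (λ k r → let n = k :+ (con (+ 3) :+ k :+ r) ; 2k = k :+ (k :+ con (+ 0)) in
                    (n :- k :+ con (+ 1)) :* (n :- k) :* (n :- k) :* (n :- 2k :- con (+ 3))
                    := (con (+ 4) :+ k :+ r) :* (con (+ 3) :+ k :+ r) :* (con (+ 3) :+ k :+ r) :* r) refl (+ k) (+ r)

    C₂*[1+k]≡C₁*[3+k+r] : C₂ ℕ.* suc k ≡ C₁ ℕ.* (3 ℕ.+ k ℕ.+ r)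
    C₂*[1+k]≡C₁*[3+k+r] = choose-step-lower k (3 ℕ.+ k ℕ.+ r)

    C₁*k≡C₀*[4+k+r] : C₁ ℕ.* k ≡ C₀ ℕ.* (4 ℕ.+ k ℕ.+ r)
    C₁*k≡C₀*[4+k+r] = subst (λ N → choose N k ℕ.* k ≡ choose N k′ ℕ.* (4 ℕ.+ k ℕ.+ r)) (ℕ.+-suc k′ (3 ℕ.+ k ℕ.+ r))
                            (choose-step-lower k′ (4 ℕ.+ k ℕ.+ r))

    C₂*[1+k]*k≡C₀*[4+k+r]*[3+k+r] : C₂ ℕ.* suc k ℕ.* k ≡ C₀ ℕ.* (4 ℕ.+ k ℕ.+ r) ℕ.* (3 ℕ.+ k ℕ.+ r)
    C₂*[1+k]*k≡C₀*[4+k+r]*[3+k+r] = begin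
      C₂ ℕ.* suc k ℕ.* k                          ≡⟨ cong (ℕ._* k) C₂*[1+k]≡C₁*[3+k+r] ⟩
      C₁ ℕ.* (3 ℕ.+ k ℕ.+ r) ℕ.* k                ≡⟨ solve 3 (λ a b c → a :* b :* c := a :* c :* b) refl C₁ (3 ℕ.+ k ℕ.+ r) k ⟩
      C₁ ℕ.* k ℕ.* (3 ℕ.+ k ℕ.+ r)                ≡⟨ cong (ℕ._* (3 ℕ.+ k ℕ.+ r)) C₁*k≡C₀*[4+k+r] ⟩
      C₀ ℕ.* (4 ℕ.+ k ℕ.+ r) ℕ.* (3 ℕ.+ k ℕ.+ r)  ∎
      where
      open ≡-Reasoning
      open ℕ-Solver

    e₂ e₁′ e₁ e₀ L : ℕ
    e₂  = k ℕ.* suc k ℕ.* suc k ℕ.* suc p ℕ.* (2 ℕ.+ r)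
    e₁′ = k ℕ.* (2 ℕ.+ r)
    e₁  = k ℕ.* suc k
    e₀  = suc k
    L   = e₂ ℕ.* (2 ℕ.+ k)

    numerators : ∀ T₂ T₁′ T₁ T₀ → c₂ k r ℕ.* T₂ ℕ.+ c₀ k r ℕ.* T₀ ≡ c₁′ k r ℕ.* T₁′ ℕ.+ c₁ k r ℕ.* T₁ →
      e₂ ℕ.* (C₂ ℕ.* T₂) ℕ.+ e₀ ℕ.* (Nc ℕ.* (C₀ ℕ.* T₀)) ≡ e₁′ ℕ.* (Na ℕ.* (C₁ ℕ.* T₁′)) ℕ.+ e₁ ℕ.* (Nb ℕ.* (C₁ ℕ.* T₁))
    numerators T₂ T₁′ T₁ T₀ identity = begin
      e₂ ℕ.* (C₂ ℕ.* T₂) ℕ.+ e₀ ℕ.* (Nc ℕ.* (C₀ ℕ.* T₀))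
        ≡⟨ solve 6 (λ k′ r C₂ C₀ T₂ T₀ → let k = con 1 :+ k′ in
             k :* (con 1 :+ k) :* (con 1 :+ k) :* (con 1 :+ (k :+ r)) :* (con 2 :+ r) :* (C₂ :* T₂)
               :+ (con 1 :+ k) :* ((con 4 :+ k :+ r) :* (con 3 :+ k :+ r) :* (con 3 :+ k :+ r) :* r :* (C₀ :* T₀))
             := C₂ :* (con 1 :+ k) :* k :* ((con 1 :+ k) :* ((con 1 :+ k) :+ r) :* (con 2 :+ r) :* T₂)
               :+ C₀ :* (con 4 :+ k :+ r) :* (con 3 :+ k :+ r) :* ((con 1 :+ k) :* (con 3 :+ k :+ r) :* r :* T₀))
                 refl k′ r C₂ C₀ T₂ T₀ ⟩
      C₂ ℕ.* suc k ℕ.* k ℕ.* (c₂ k r ℕ.* T₂) ℕ.+ G ℕ.* (c₀ k r ℕ.* T₀)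
        ≡⟨ cong (λ x → x ℕ.* (c₂ k r ℕ.* T₂) ℕ.+ G ℕ.* (c₀ k r ℕ.* T₀)) C₂*[1+k]*k≡C₀*[4+k+r]*[3+k+r] ⟩
      G ℕ.* (c₂ k r ℕ.* T₂) ℕ.+ G ℕ.* (c₀ k r ℕ.* T₀)
        ≡⟨ ℕ.*-distribˡ-+ G (c₂ k r ℕ.* T₂) (c₀ k r ℕ.* T₀) ⟨
      G ℕ.* (c₂ k r ℕ.* T₂ ℕ.+ c₀ k r ℕ.* T₀)
        ≡⟨ cong (G ℕ.*_) identity ⟩
      G ℕ.* (c₁′ k r ℕ.* T₁′ ℕ.+ c₁ k r ℕ.* T₁)
        ≡⟨ ℕ.*-assoc (C₀ ℕ.* (4 ℕ.+ k ℕ.+ r)) (3 ℕ.+ k ℕ.+ r) _ ⟩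
      C₀ ℕ.* (4 ℕ.+ k ℕ.+ r) ℕ.* ((3 ℕ.+ k ℕ.+ r) ℕ.* (c₁′ k r ℕ.* T₁′ ℕ.+ c₁ k r ℕ.* T₁))
        ≡⟨ cong (ℕ._* ((3 ℕ.+ k ℕ.+ r) ℕ.* (c₁′ k r ℕ.* T₁′ ℕ.+ c₁ k r ℕ.* T₁))) C₁*k≡C₀*[4+k+r] ⟨
      C₁ ℕ.* k ℕ.* ((3 ℕ.+ k ℕ.+ r) ℕ.* (c₁′ k r ℕ.* T₁′ ℕ.+ c₁ k r ℕ.* T₁))
        ≡⟨ solve 5 (λ k′ r C₁ T₁′ T₁ → let k = con 1 :+ k′ in
             C₁ :* k :* ((con 3 :+ k :+ r) :* ((con 2 :+ r) :* (con 1 :+ r) :* r :* T₁′ :+ con 2 :* (con 1 :+ k) :* (con 2 :+ k :+ r) :* (con 1 :+ r) :* T₁))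
             := k :* (con 2 :+ r) :* ((con 3 :+ k :+ r) :* (con 1 :+ r) :* r :* (C₁ :* T₁′))
               :+ k :* (con 1 :+ k) :* (con 2 :* (con 3 :+ k :+ r) :* (con 2 :+ k :+ r) :* (con 1 :+ r) :* (C₁ :* T₁)))
                 refl k′ r C₁ T₁′ T₁ ⟩
      e₁′ ℕ.* (Na ℕ.* (C₁ ℕ.* T₁′)) ℕ.+ e₁ ℕ.* (Nb ℕ.* (C₁ ℕ.* T₁)) ∎
      where
      open ≡-Reasoning
      open ℕ-Solver
      G = C₀ ℕ.* (4 ℕ.+ k ℕ.+ r) ℕ.* (3 ℕ.+ k ℕ.+ r)

    three-term-step : ∀ {W₂ W₁′ W₁ W₀} T₂ T₁′ T₁ T₀ →
      c₂ k r ℕ.* T₂ ℕ.+ c₀ k r ℕ.* T₀ ≡ c₁′ k r ℕ.* T₁′ ℕ.+ c₁ k r ℕ.* T₁ →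
      W₂ ≐ C₂ ℕ.* T₂ / suc (suc k) → W₁′ ≐ C₁ ℕ.* T₁′ / suc k → W₁ ≐ C₁ ℕ.* T₁ / suc k → W₀ ≐ C₀ ℕ.* T₀ / k →
      W₂ ≡ a n k * W₁′ + b n k * W₁ - c n k * W₀
    three-term-step T₂ T₁′ T₁ T₀ identity w₂ w₁′ w₁ w₀ =
      ≐-combination L
        (≐-rescale e₂  w₂ refl)
        (≐-rescale e₁′ (≐-* a-≐ w₁′) (solve 2 (λ k′ r → let k = con 1 :+ k′ in
           k :* (con 1 :+ k) :* (con 1 :+ k) :* (con 1 :+ (k :+ r)) :* (con 2 :+ r) :* (con 2 :+ k)
           := k :* (con 2 :+ r) :* ((k :+ con 1) :* (k :+ con 2) :* (con 1 :+ (k :+ r)) :* (con 1 :+ k))) refl k′ r))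
        (≐-rescale e₁  (≐-* b-≐ w₁) (solve 2 (λ k′ r → let k = con 1 :+ k′ in
           k :* (con 1 :+ k) :* (con 1 :+ k) :* (con 1 :+ (k :+ r)) :* (con 2 :+ r) :* (con 2 :+ k)
           := k :* (con 1 :+ k) :* ((k :+ con 2) :* (con 1 :+ (k :+ r)) :* (con 2 :+ r) :* (con 1 :+ k))) refl k′ r))
        (≐-rescale e₀  (≐-* c-≐ w₀) (solve 2 (λ k′ r → let k = con 1 :+ k′ in
           k :* (con 1 :+ k) :* (con 1 :+ k) :* (con 1 :+ (k :+ r)) :* (con 2 :+ r) :* (con 2 :+ k)
           := (con 1 :+ k) :* ((k :+ con 1) :* (k :+ con 2) :* (con 1 :+ (k :+ r)) :* (con 2 :+ r) :* k)) refl k′ r))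
        (numerators T₂ T₁′ T₁ T₀ identity)
      where open ℕ-Solver

    w₂-≐ : ∀ j → w n (suc (suc k)) (suc j) ≐ C₂ ℕ.* (choose p j ℕ.* choose (suc (suc k)) (suc j)) / suc (suc k)
    w₂-≐ j = w-≐ n (suc k) j p (solve 2 (λ k r → k :+ (con 3 :+ k :+ r) := con 2 :+ k :+ con 1 :+ (k :+ r)) refl k r)
      where open ℕ-Solver

    w₁-≐ : ∀ j → w n (suc k) (suc j) ≐ C₁ ℕ.* (choose (suc p) j ℕ.* choose (suc k) (suc j)) / suc k
    w₁-≐ j = w-≐ n k j (suc p) (solve 2 (λ k r → k :+ (con 3 :+ k :+ r) := con 1 :+ k :+ con 1 :+ (con 1 :+ (k :+ r))) refl k r)
      where open ℕ-Solver

    w₀-≐ : ∀ j → w n k (suc j) ≐ C₀ ℕ.* (choose (2 ℕ.+ p) j ℕ.* choose k (suc j)) / k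
    w₀-≐ j = w-≐ n k′ j (2 ℕ.+ p) (solve 2 (λ k′ r → let k = con 1 :+ k′ in
               k :+ (con 3 :+ k :+ r) := con 1 :+ k′ :+ con 1 :+ (con 2 :+ (k :+ r))) refl k′ r)
      where open ℕ-Solver

    n≢ : ∀ K → K ℕ.≤ suc (suc k) → n ≢ K
    n≢ K K≤2+k = ℕ.>⇒≢ (ℕ.≤-trans (s≤s K≤2+k) (ℕ.≤-trans (ℕ.m≤m+n (3 ℕ.+ k) r) (ℕ.m≤n+m (3 ℕ.+ k ℕ.+ r) k)))

    w-recurrence : ∀ m → m ℕ.≤ suc (suc k) →
      w n (suc (suc k)) m ≡ a n k * shift (w n (suc k)) m + b n k * w n (suc k) m - c n k * w n k m
    w-recurrence zero _ =
      three-term-step 0 0 0 0 trivial (constant-term (suc (suc k)) ℕ.≤-refl C₂) (≐-zero (suc k) refl (ℕ.*-zeroʳ C₁))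
                      (constant-term (suc k) (ℕ.n≤1+n _) C₁) (constant-term k (ℕ.m≤n+m k 2) C₀)
      where
      trivial : c₂ k r ℕ.* 0 ℕ.+ c₀ k r ℕ.* 0 ≡ c₁′ k r ℕ.* 0 ℕ.+ c₁ k r ℕ.* 0
      trivial = trans (cong₂ ℕ._+_ (ℕ.*-zeroʳ (c₂ k r)) (ℕ.*-zeroʳ (c₀ k r))) (sym (cong₂ ℕ._+_ (ℕ.*-zeroʳ (c₁′ k r)) (ℕ.*-zeroʳ (c₁ k r))))
      constant-term : ∀ K → K ℕ.≤ suc (suc k) → ∀ C {D} → w n K 0 ≐ C ℕ.* 0 / D
      constant-term K K≤2+k C {D} = ≐-zero D (w-constant-term n K (n≢ K K≤2+k)) (ℕ.*-zeroʳ C)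
    w-recurrence (suc zero) _ =
      three-term-step _ 0 _ _ (binomial-identity-linear k r)
        (w₂-≐ 0) (≐-zero (suc k) (w-constant-term n (suc k) (n≢ (suc k) (ℕ.n≤1+n _))) (ℕ.*-zeroʳ C₁)) (w₁-≐ 0) (w₀-≐ 0)
    w-recurrence (suc (suc t)) (s≤s (s≤s t≤k)) =
      three-term-step _ _ _ _ (binomial-identity k r t t≤k) (w₂-≐ (suc t)) (w₁-≐ t) (w₁-≐ (suc t)) (w₀-≐ (suc t))

    W-recurrence : ∀ x → W n (suc (suc k)) x ≡ (a n k * x + b n k) * W n (suc k) x - c n k * W n k x
    W-recurrence x = poly-three-term k x (a n k) (b n k) (c n k) _ _ _ w-recurrence
      (w-above-degree n (suc k) (suc k) (ℕ.n<1+n (suc k)))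
      (w-above-degree n k k (ℕ.n<1+n k))
      (w-above-degree n k (suc k) (ℕ.m<n⇒m<1+n (ℕ.n<1+n k)))

open import Data.Nat using (ℕ; _≤_; _∸_; _+_; suc)
open import Data.Nat.DivMod using (_/_)
open import Data.Rational using (ℚ; _-_; _*_) renaming (_+_ to _+ℚ_)
open import Relation.Binary.PropositionalEquality using (_≡_)
import Data.Nat as ℕ
open import Data.Nat.Properties
open import Data.Nat.DivMod using (m/n*n≤m)
open import Data.Nat.Solver using (module +-*-Solver)
open import Relation.Nullary.Negation using (contradiction)
open import Relation.Binary.PropositionalEquality using (refl; subst; subst₂; trans)
open Coefficients using (module ThreeTerm)

2k+3≤n : ∀ n k → 1 ≤ k → k ≤ suc n / 2 ∸ 2 → k + k + 3 ≤ n
2k+3≤n n k 1≤k k≤half∸2 = ≤-pred (subst (_≤ suc n) [k+2]*2≡ (≤-trans (*-monoˡ-≤ 2 k+2≤half) (m/n*n≤m (suc n) 2)))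
  where
  open +-*-Solver
  half = suc n / 2
  2≤half : 2 ≤ half
  2≤half = <⇒≤ (m∸n≢0⇒n<m (λ half∸2≡0 → contradiction (subst (k ≤_) half∸2≡0 k≤half∸2) (<⇒≱ 1≤k)))
  k+2≤half : k + 2 ≤ half
  k+2≤half = m≤o∸n⇒m+n≤o k 2≤half k≤half∸2
  [k+2]*2≡ : (k + 2) ℕ.* 2 ≡ suc (k + k + 3)
  [k+2]*2≡ = solve 1 (λ k → (k :+ con 2) :* con 2 := con 1 :+ (k :+ k :+ con 3)) refl k

theorem2p6 : (n k : ℕ) → 1 ≤ n → 1 ≤ k → k ≤ (suc n / 2) ∸ 2 →
    (x : ℚ) →
    W n (k + 2) x ≡ ((a n k * x +ℚ b n k) * W n (k + 1) x - c n k * W n k x)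
theorem2p6 n ℕ.zero   _ ()  _     _
theorem2p6 n (suc k′) _ 1≤k bound x =
  subst₂ (λ A B → W n A x ≡ (a n k * x +ℚ b n k) * W n B x - c n k * W n k x) (+-comm 2 k) (+-comm 1 k)
    (subst (λ N → W N (2 + k) x ≡ (a N k * x +ℚ b N k) * W N (1 + k) x - c N k * W N k x) n≡ (W-recurrence x))
  where
  open +-*-Solver
  k = suc k′
  r = n ∸ (k + k + 3)
  open ThreeTerm k′ r using (W-recurrence)
  n≡ : k + (3 + k + r) ≡ n
  n≡ = trans (solve 2 (λ k r → k :+ (con 3 :+ k :+ r) := k :+ k :+ con 3 :+ r) refl k r) (m+[n∸m]≡n (2k+3≤n n k 1≤k bound))
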